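{- If $G$ and $H$ are graphs, then $$\iota(G\,\Box\, H) \leq \min\{\alpha(G)\iota(H)+ \beta(G)\gamma(H),\ \alpha(H)\iota(G)+ \beta(H)\gamma(G)\}.$$
   Context: All graphs are finite and simple. $G\,\Box\,H$ is the Cartesian product. A set $A\subseteq V(G)$ is an isolating set if no two vertices outside $N[A]$ (the closed neighborhood of $A$) are adjacent; $\iota(G)$ is the minimum size of an isolating set. $\alpha$ is the independence number, $\beta$ the vertex cover number, $\gamma$ the domination number. -}

module Defs where

open import Level using (0ℓ)
open import Data.Nat using (ℕ; _≤_; _+_; _*_; _⊔_; _⊓_)
open import Data.Product using (Σ; _×_; _,_; proj₁; proj₂; ∃)
open import Data.Sum using (_⊎_)
open import Data.List using (List; length)
open import Data.List.Membership.Propositional using (_∈_)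
open import Data.List.Relation.Unary.Unique.Propositional using (Unique)
open import Data.List.Relation.Unary.Any using (Any)
open import Relation.Binary.PropositionalEquality using (_≡_)
open import Relation.Nullary using (¬_)

record Graph : Set₁ where
  field
    V      : Set
    verts  : List V
    unique : Unique verts
    complete : ∀ v → v ∈ verts
    Adj    : V → V → Set
    sym    : ∀ {u v} → Adj u v → Adj v u
    irrefl : ∀ {v} → ¬ Adj v v
open Graph public

record VSet (G : Graph) : Set where
  constructor vset
  field
    elems : List (V G)
    nodup : Unique elems
open VSet public

size : ∀ {G} → VSet G → ℕ
size A = length (elems A)

InClosedNbhd : (G : Graph) → VSet G → V G → Set
InClosedNbhd G A v = Any (λ a → a ≡ v ⊎ Adj G a v) (elems A)

IsIndependent : (G : Graph) → VSet G → Set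
IsIndependent G A = ∀ u v → u ∈ elems A → v ∈ elems A → ¬ Adj G u v

IsVertexCover : (G : Graph) → VSet G → Set
IsVertexCover G A = ∀ u v → Adj G u v → u ∈ elems A ⊎ v ∈ elems A

IsDominating : (G : Graph) → VSet G → Set
IsDominating G A = ∀ v → InClosedNbhd G A v

IsIsolating : (G : Graph) → VSet G → Set
IsIsolating G A = ∀ u v → ¬ InClosedNbhd G A u → ¬ InClosedNbhd G A v → ¬ Adj G u v

IsMax : (G : Graph) → (VSet G → Set) → ℕ → Set
IsMax G P k = (Σ (VSet G) λ A → P A × size A ≡ k) × (∀ A → P A → size A ≤ k)

IsMin : (G : Graph) → (VSet G → Set) → ℕ → Set
IsMin G P k = (Σ (VSet G) λ A → P A × size A ≡ k) × (∀ A → P A → k ≤ size A)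

α[_]≡_ : Graph → ℕ → Set
α[ G ]≡ k = IsMax G (IsIndependent G) k

β[_]≡_ : Graph → ℕ → Set
β[ G ]≡ k = IsMin G (IsVertexCover G) k

γ[_]≡_ : Graph → ℕ → Set
γ[ G ]≡ k = IsMin G (IsDominating G) k

ι[_]≡_ : Graph → ℕ → Set
ι[ G ]≡ k = IsMin G (IsIsolating G) k

open import Data.List using (cartesianProduct)
open import Data.List.Membership.Propositional.Properties using (∈-cartesianProduct⁺)
open import Data.List.Relation.Unary.Unique.Propositional.Properties using (cartesianProduct⁺)
open import Relation.Binary.PropositionalEquality using (refl; cong₂)
import Relation.Binary.PropositionalEquality as Eq
open import Data.Empty using (⊥-elim)
open import Data.Sum using (inj₁; inj₂)

_□_ : Graph → Graph → Graph
G □ H = record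
  { V = V G × V H
  ; verts = cartesianProduct (verts G) (verts H)
  ; unique = cartesianProduct⁺ (unique G) (unique H)
  ; complete = λ { (g , h) → ∈-cartesianProduct⁺ (complete G g) (complete H h) }
  ; Adj = λ { (g , h) (g' , h') → (g ≡ g' × Adj H h h') ⊎ (h ≡ h' × Adj G g g') }
  ; sym = λ { (inj₁ (e , a)) → inj₁ (Eq.sym e , Graph.sym H a)
            ; (inj₂ (e , a)) → inj₂ (Eq.sym e , Graph.sym G a) }
  ; irrefl = λ { (inj₁ (_ , a)) → irrefl H a ; (inj₂ (_ , a)) → irrefl G a }
  }

module Submission where

open import Defs
open import Data.Nat using (ℕ; _≤_; _+_; _*_; _⊓_)
open import Data.Nat.Properties using (≤-trans; ≤-reflexive; +-monoˡ-≤; *-monoˡ-≤; ⊓-glb; module ≤-Reasoning)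
open import Data.Product using (_×_; _,_; proj₁; proj₂; swap)
open import Data.Sum using (_⊎_; inj₁; inj₂)
open import Data.List using (List; []; _∷_; length; map; _++_; filter; cartesianProduct; lookup)
open import Data.List.Properties using (length-++; length-map)
open import Data.List.Membership.Propositional using (_∈_; find; lose)
open import Data.List.Membership.Propositional.Properties
  using (∈-cartesianProduct⁺; ∈-cartesianProduct⁻; ∈-filter⁺; ∈-filter⁻)
open import Data.List.Relation.Unary.Any as Any using (Any; index; any?)
open import Data.List.Relation.Unary.Any.Properties using (lookup-index; ++⁺ˡ; ++⁺ʳ; map⁺)
import Data.List.Relation.Unary.Unique.Propositional.Properties as Unique
open import Data.Fin using () renaming (_≟_ to _≟ᶠ_)
open import Relation.Binary.Definitions using (DecidableEquality)
open import Relation.Binary.PropositionalEquality using (_≡_; refl; trans; cong; cong₂; module ≡-Reasoning)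
open import Relation.Nullary using (¬_; Dec; yes; no)
open import Relation.Nullary.Decidable using (map′; ¬?)

-- Take a vertex cover C and an independent set I = V(G) ∖ C of G, a dominating set D and an
-- isolating set S of H, and put A = (I × S) ∪ (C × D). Every (g , h) with g ∈ C is dominated
-- by C × D. An edge of G □ H inside a G-fibre has an endpoint with first coordinate in C; an
-- edge inside an H-fibre over g ∉ C lies in the copy of H over g ∈ I, where I × S isolates it
-- as S does in H. Hence A is isolating and ι(G □ H) ≤ |I| ι(H) + |C| γ(H) ≤ α(G) ι(H) + β(G) γ(H);
-- the other bound is the same argument for H □ G ≅ G □ H.

vertex-≟ : (G : Graph) → DecidableEquality (V G)
vertex-≟ G u v = map′ from-index (λ { refl → refl }) (index (complete G u) ≟ᶠ index (complete G v))
  where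
  open ≡-Reasoning
  from-index : index (complete G u) ≡ index (complete G v) → u ≡ v
  from-index e = begin
    u                                       ≡⟨ lookup-index (complete G u) ⟩
    lookup (verts G) (index (complete G u)) ≡⟨ cong (lookup (verts G)) e ⟩
    lookup (verts G) (index (complete G v)) ≡⟨ lookup-index (complete G v) ⟨
    v                                       ∎

length-cartesianProduct : ∀ {A B : Set} (xs : List A) (ys : List B) →
                          length (cartesianProduct xs ys) ≡ length xs * length ys
length-cartesianProduct []       ys = refl
length-cartesianProduct (x ∷ xs) ys =
  trans (length-++ (map (x ,_) ys)) (cong₂ _+_ (length-map (x ,_) ys) (length-cartesianProduct xs ys))

module _ {G : Graph} (C : VSet G) where

  private
    ∉C? : ∀ g → Dec (¬ g ∈ elems C)
    ∉C? g = ¬? (any? (vertex-≟ G g) (elems C))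

  complementOf : VSet G
  complementOf = vset (filter ∉C? (verts G)) (Unique.filter⁺ ∉C? (unique G))

  ∈-complementOf⁺ : ∀ {g} → ¬ g ∈ elems C → g ∈ elems complementOf
  ∈-complementOf⁺ {g} g∉C = ∈-filter⁺ ∉C? (complete G g) g∉C

  ∈-complementOf⁻ : ∀ {g} → g ∈ elems complementOf → ¬ g ∈ elems C
  ∈-complementOf⁻ g∈ = proj₂ (∈-filter⁻ ∉C? {xs = verts G} g∈)

  complementOf-cover-isIndependent : IsVertexCover G C → IsIndependent G complementOf
  complementOf-cover-isIndependent cover u v u∈ v∈ u~v with cover u v u~v
  ... | inj₁ u∈C = ∈-complementOf⁻ u∈ u∈C
  ... | inj₂ v∈C = ∈-complementOf⁻ v∈ v∈C

  ∈-or-∈-complementOf : ∀ g → g ∈ elems C ⊎ g ∈ elems complementOf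
  ∈-or-∈-complementOf g with any? (vertex-≟ G g) (elems C)
  ... | yes g∈C = inj₁ g∈C
  ... | no  g∉C = inj₂ (∈-complementOf⁺ g∉C)

closedNbhd-fibre⁺ : (G H : Graph) {g : V G} {h : V H} {X : List (V G)} {Y : List (V H)} →
                    g ∈ X → Any (λ d → d ≡ h ⊎ Adj H d h) Y →
                    Any (λ a → a ≡ (g , h) ⊎ Adj (G □ H) a (g , h)) (cartesianProduct X Y)
closedNbhd-fibre⁺ G H {g} g∈X h∈N[Y] with find h∈N[Y]
... | d , d∈Y , inj₁ d≡h = lose (∈-cartesianProduct⁺ g∈X d∈Y) (inj₁ (cong (g ,_) d≡h))
... | d , d∈Y , inj₂ d~h = lose (∈-cartesianProduct⁺ g∈X d∈Y) (inj₂ (inj₁ (refl , d~h)))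

module _ {G H : Graph} (C : VSet G) (D S : VSet H) where

  private
    I×S C×D : List (V G × V H)
    I×S = cartesianProduct (elems (complementOf C)) (elems S)
    C×D = cartesianProduct (elems C) (elems D)

    I×S∩C×D≡∅ : ∀ {x} → ¬ (x ∈ I×S × x ∈ C×D)
    I×S∩C×D≡∅ (x∈I×S , x∈C×D) =
      ∈-complementOf⁻ C (proj₁ (∈-cartesianProduct⁻ _ (elems S) x∈I×S))
                        (proj₁ (∈-cartesianProduct⁻ (elems C) (elems D) x∈C×D))

  coverIsolatingSet : VSet (G □ H)
  coverIsolatingSet = vset (I×S ++ C×D)
    (Unique.++⁺ (Unique.cartesianProduct⁺ (nodup (complementOf C)) (nodup S))
                (Unique.cartesianProduct⁺ (nodup C) (nodup D)) I×S∩C×D≡∅)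

  size-coverIsolatingSet : size coverIsolatingSet ≡ size (complementOf C) * size S + size C * size D
  size-coverIsolatingSet =
    trans (length-++ I×S {C×D})
          (cong₂ _+_ (length-cartesianProduct (elems (complementOf C)) (elems S))
                     (length-cartesianProduct (elems C) (elems D)))

  coverIsolatingSet-isIsolating : IsVertexCover G C → IsDominating H D → IsIsolating H S →
                                  IsIsolating (G □ H) coverIsolatingSet
  coverIsolatingSet-isIsolating cover dom iso (g , h) (g' , h') (g,h∉N) (g',h'∉N) = isolated
    where
    dominated : ∀ {g} h → g ∈ elems C → InClosedNbhd (G □ H) coverIsolatingSet (g , h)
    dominated h g∈C = ++⁺ʳ I×S (closedNbhd-fibre⁺ G H g∈C (dom h))

    isolated : ¬ Adj (G □ H) (g , h) (g' , h')
    isolated (inj₂ (refl , g~g')) with cover g g' g~g'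
    ... | inj₁ g∈C  = g,h∉N (dominated h g∈C)
    ... | inj₂ g'∈C = g',h'∉N (dominated h g'∈C)
    isolated (inj₁ (refl , h~h')) with ∈-or-∈-complementOf C g
    ... | inj₁ g∈C = g,h∉N (dominated h g∈C)
    ... | inj₂ g∈I = iso h h' (λ h∈N → g,h∉N (++⁺ˡ (closedNbhd-fibre⁺ G H g∈I h∈N)))
                              (λ h'∈N → g',h'∉N (++⁺ˡ (closedNbhd-fibre⁺ G H g∈I h'∈N))) h~h'

swap-Adj : ∀ {G H : Graph} {x y} → Adj (H □ G) x y → Adj (G □ H) (swap x) (swap y)
swap-Adj (inj₁ x~y) = inj₂ x~y
swap-Adj (inj₂ x~y) = inj₁ x~y

module _ {G H : Graph} where

  swapVSet : VSet (H □ G) → VSet (G □ H)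
  swapVSet A = vset (map swap (elems A)) (Unique.map⁺ swap-injective (nodup A))
    where
    swap-injective : ∀ {x y : V H × V G} → swap x ≡ swap y → x ≡ y
    swap-injective refl = refl

  size-swapVSet : ∀ A → size (swapVSet A) ≡ size A
  size-swapVSet A = length-map swap (elems A)

  swapVSet-closedNbhd⁺ : ∀ A x → InClosedNbhd (H □ G) A (swap x) → InClosedNbhd (G □ H) (swapVSet A) x
  swapVSet-closedNbhd⁺ A x x∈N[A] = map⁺ (Any.map swap-step x∈N[A])
    where
    swap-step : ∀ {a} → a ≡ swap x ⊎ Adj (H □ G) a (swap x) → swap a ≡ x ⊎ Adj (G □ H) (swap a) x
    swap-step (inj₁ refl) = inj₁ refl
    swap-step (inj₂ a~x)  = inj₂ (swap-Adj {G} {H} a~x)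

  swapVSet-isIsolating : ∀ A → IsIsolating (H □ G) A → IsIsolating (G □ H) (swapVSet A)
  swapVSet-isIsolating A iso x y x∉N y∉N x~y =
    iso (swap x) (swap y) (λ x∈N → x∉N (swapVSet-closedNbhd⁺ A x x∈N))
                          (λ y∈N → y∉N (swapVSet-closedNbhd⁺ A y y∈N)) (swap-Adj {H} {G} x~y)

ι-□-≤ : ∀ {G H : Graph} {aG bG gH iH k : ℕ} → α[ G ]≡ aG → β[ G ]≡ bG → γ[ H ]≡ gH → ι[ H ]≡ iH →
        (∀ A → IsIsolating (G □ H) A → k ≤ size A) → k ≤ aG * iH + bG * gH
ι-□-≤ {G} {H} {aG} {k = k} (_ , α-max) ((C , cover , refl) , _) ((D , dom , refl) , _)
      ((S , iso , refl) , _) k-min = begin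
  k                                                   ≤⟨ k-min A (coverIsolatingSet-isIsolating C D S cover dom iso) ⟩
  size A                                              ≡⟨ size-coverIsolatingSet C D S ⟩
  size (complementOf C) * size S + size C * size D    ≤⟨ +-monoˡ-≤ (size C * size D) (*-monoˡ-≤ (size S) I≤α) ⟩
  aG * size S + size C * size D                       ∎
  where
  open ≤-Reasoning
  A : VSet (G □ H)
  A = coverIsolatingSet C D S
  I≤α : size (complementOf C) ≤ aG
  I≤α = α-max (complementOf C) (complementOf-cover-isIndependent C cover)

proposition3p1 : (G H : Graph) (aG aH bG bH gG gH iG iH iGH : ℕ)
    → α[ G ]≡ aG → α[ H ]≡ aH → β[ G ]≡ bG → β[ H ]≡ bH
    → γ[ G ]≡ gG → γ[ H ]≡ gH → ι[ G ]≡ iG → ι[ H ]≡ iH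
    → ι[ G □ H ]≡ iGH
    → iGH ≤ (aG * iH + bG * gH) ⊓ (aH * iG + bH * gG)
proposition3p1 G H aG aH bG bH gG gH iG iH iGH αG αH βG βH γG γH ιG ιH (_ , ι-min) =
  ⊓-glb (ι-□-≤ αG βG γH ιH ι-min) (ι-□-≤ αH βH γG ιG ι-min-swapped)
  where
  ι-min-swapped : ∀ A → IsIsolating (H □ G) A → iGH ≤ size A
  ι-min-swapped A iso = ≤-trans (ι-min (swapVSet A) (swapVSet-isIsolating A iso)) (≤-reflexive (size-swapVSet A))
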